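{- Let $\mathcal{R}$ be a finite valuation ring of order $q^r$, and let $\mathcal{E}$ be a set of $3q^{2r-1}$ points in $\mathcal{R}^2$. Then the number of distinct lines in $\mathcal{R}^2$ containing at least $q^{r-1}+1$ points of $\mathcal{E}$ is at least $q^{2r}/4$.
   Context: $\mathcal{R}$ is a finite valuation ring: a finite commutative local ring with identity whose ideals are totally ordered by inclusion (a finite chain ring); its residue field has $q$ elements, $q$ an odd prime power, and $|\mathcal{R}|=q^r$; $\mathcal{R}^0$ denotes its set of non-units. A line in $\mathcal{R}^2$ is a set $\{(x,y)\in\mathcal{R}^2\colon ax+by+c=0\}$ with $(a,b,c)\in\mathcal{R}^3\setminus(\mathcal{R}^0)^3$. -}

module Defs where

open import Level using (0ℓ)
open import Algebra.Bundles using (CommutativeRing)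
open import Data.Nat as ℕ using (ℕ; _^_; _∸_)
open import Data.Nat.Primality using (Prime)
open import Data.Product using (Σ; ∃; _×_; _,_; proj₁; proj₂)
open import Data.Sum using (_⊎_)
open import Data.List using (List; length; filter)
open import Data.List.Relation.Unary.Any using (Any)
open import Data.List.Relation.Unary.All using (All)
open import Data.List.Relation.Unary.AllPairs using (AllPairs)
open import Relation.Nullary using (¬_; Dec)
open import Relation.Binary.PropositionalEquality using (_≡_)

-- A finite valuation ring (finite chain ring): a finite commutative ring with
-- identity (decidable equality, explicit complete duplicate-free enumeration),
-- local (non-units closed under addition, 1 ≉ 0), whose (principal) ideals are
-- totally ordered by inclusion.
record FiniteValuationRing : Set₁ where
  field
    cring : CommutativeRing 0ℓ 0ℓ
  open CommutativeRing cring public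
  field
    _≟_      : (x y : Carrier) → Dec (x ≈ y)
    elems    : List Carrier
    complete : ∀ x → Any (x ≈_) elems
    distinct : AllPairs (λ x y → ¬ x ≈ y) elems

  IsUnit : Carrier → Set
  IsUnit x = ∃ λ y → x * y ≈ 1#

  NonUnit : Carrier → Set
  NonUnit x = ¬ IsUnit x

  _∈⟨_⟩ : Carrier → Carrier → Set
  x ∈⟨ a ⟩ = ∃ λ c → x ≈ c * a

  _⊆⟨_⟩ : Carrier → Carrier → Set
  a ⊆⟨ b ⟩ = ∀ x → x ∈⟨ a ⟩ → x ∈⟨ b ⟩

  field
    nontrivial : ¬ (1# ≈ 0#)
    local      : ∀ x y → NonUnit x → NonUnit y → NonUnit (x + y)
    chain      : ∀ a b → a ⊆⟨ b ⟩ ⊎ b ⊆⟨ a ⟩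

  order : ℕ
  order = length elems

  -- the residue field R/R⁰ has exactly q elements: a complete,
  -- pairwise incongruent list of q coset representatives
  ResidueFieldSize : ℕ → Set
  ResidueFieldSize q = Σ (List Carrier) λ reps →
      length reps ≡ q
    × (∀ x → Any (λ t → NonUnit (x - t)) reps)
    × AllPairs (λ s t → ¬ NonUnit (s - t)) reps

  Point : Set
  Point = Carrier × Carrier

  _≈ₚ_ : Point → Point → Set
  (x , y) ≈ₚ (x' , y') = (x ≈ x') × (y ≈ y')

  Coeffs : Set
  Coeffs = Carrier × Carrier × Carrier

  IsLineCoeffs : Coeffs → Set
  IsLineCoeffs (a , b , c) = ¬ (NonUnit a × NonUnit b × NonUnit c)

  OnLine : Coeffs → Point → Set
  OnLine (a , b , c) (x , y) = (a * x + b * y + c) ≈ 0#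

  onLine? : ∀ ℓ P → Dec (OnLine ℓ P)
  onLine? (a , b , c) (x , y) = _≟_ (a * x + b * y + c) 0#

  SameLine : Coeffs → Coeffs → Set
  SameLine ℓ m = ∀ P → (OnLine ℓ P → OnLine m P) × (OnLine m P → OnLine ℓ P)

  pointsOn : Coeffs → List Point → ℕ
  pointsOn ℓ E = length (filter (onLine? ℓ) E)

OddPrimePower : ℕ → Set
OddPrimePower q = Σ ℕ λ p → Σ ℕ λ k →
  Prime p × ¬ (p ≡ 2) × (1 ℕ.≤ k) × (q ≡ p ^ k)

module Submission where

-- Count incidences between E and the |R|² lines y = mx + c with m, c ∈ R, writing
-- i(ℓ) for the number of points of E on ℓ. Every point lies on exactly one such line
-- of each slope, so Σ i(ℓ) = |E||R| and the mean incidence is μ = 3q^(r-1). Two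
-- points lie on a common line of slope m only if m(x' - x) = y' - y: when x' - x is
-- a unit this fixes m, and for fixed P and m at most |R⁰| ≤ q^(r-1) points
-- P + u(1, m) have a nonunit step u. Hence Σ i(ℓ)² ≤ |E|(|E| + |R||R⁰|), and since
-- |E| = μ|R| the second moment about the mean is at most |E||R||R⁰| ≤ 3q^(2r)q^(2r-2).
-- A line with at most q^(r-1) points deviates from μ by at least 2q^(r-1), so at
-- most three quarters of the lines are of this kind.

open import Algebra.Bundles using (CommutativeRing)
open import Data.Bool.Base using (if_then_else_)
open import Data.Empty using (⊥-elim)
open import Data.List.Base using (List; []; _∷_; _++_; length; filter; map; cartesianProductWith)
open import Data.List.Properties using (length-map)
open import Data.List.Relation.Unary.All as All using (All; []; _∷_)
import Data.List.Relation.Unary.All.Properties as All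
open import Data.List.Relation.Unary.AllPairs using (AllPairs; []; _∷_)
import Data.List.Relation.Unary.AllPairs.Properties as AllPairs
open import Data.List.Relation.Unary.Any as Any using (Any; here; there)
open import Data.Product.Base using (Σ; _×_; _,_; proj₁; proj₂)
open import Data.Product.Relation.Binary.Pointwise.NonDependent using (×-setoid)
open import Function.Base using (id; _∘_)
open import Level using (Level)
open import Relation.Binary.Bundles using (Setoid)
open import Relation.Nullary.Decidable using (Dec; yes; no; does; ¬?; _×-dec_; decidable-stable)
open import Relation.Nullary.Negation using (¬_)
open import Relation.Unary using (Pred; Decidable)
open import Defs

module CommutativeRingLemmas {r ℓ} (R : CommutativeRing r ℓ) where
  open CommutativeRing R
  open import Algebra.Properties.Ring ring using (-1*x≈-x)
  open import Algebra.Properties.Group +-group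
    using (x∙y⁻¹≈ε⇒x≈y; x≈y⇒x∙y⁻¹≈ε; ∙-cancelʳ; //-rightDividesˡ)
  open import Relation.Binary.Reasoning.Setoid setoid

  x≈y+[x-y] : ∀ x y → x ≈ y + (x - y)
  x≈y+[x-y] x y = sym (trans (+-comm y (x - y)) (//-rightDividesˡ y x))

  x+[y+z]≈[x+z]+y : ∀ x y z → x + (y + z) ≈ (x + z) + y
  x+[y+z]≈[x+z]+y x y z = trans (+-congˡ (+-comm y z)) (sym (+-assoc x z y))

  +≈+⇒-≈- : ∀ {a b c d} → a + d ≈ c + b → a - b ≈ c - d
  +≈+⇒-≈- {a} {b} {c} {d} eq = ∙-cancelʳ (b + d) (a - b) (c - d) (begin
    (a - b) + (b + d)  ≈⟨ shift a b d ⟩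
    a + d              ≈⟨ eq ⟩
    c + b              ≈⟨ shift c d b ⟨
    (c - d) + (d + b)  ≈⟨ +-congˡ (+-comm d b) ⟩
    (c - d) + (b + d)  ∎)
    where
    shift : ∀ x y z → (x - y) + (y + z) ≈ x + z
    shift x y z = trans (sym (+-assoc (x - y) y z)) (+-congʳ (//-rightDividesˡ y x))

  [x+z]-[y+z]≈x-y : ∀ x y z → (x + z) - (y + z) ≈ x - y
  [x+z]-[y+z]≈x-y x y z = +≈+⇒-≈- (sym (x+[y+z]≈[x+z]+y x y z))

  x+[-1]y+z≈0⇔x+z≈y : ∀ x y z → (x + (- 1#) * y + z ≈ 0# → x + z ≈ y)
                                × (x + z ≈ y → x + (- 1#) * y + z ≈ 0#)
  x+[-1]y+z≈0⇔x+z≈y x y z =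
    (λ eq → x∙y⁻¹≈ε⇒x≈y (x + z) y (trans (sym rearrange) eq)) ,
    (λ eq → trans rearrange (x≈y⇒x∙y⁻¹≈ε eq))
    where
    rearrange : x + (- 1#) * y + z ≈ (x + z) - y
    rearrange = begin
      x + (- 1#) * y + z  ≈⟨ +-congʳ (+-congˡ (-1*x≈-x y)) ⟩
      x + - y + z         ≈⟨ +-assoc x (- y) z ⟩
      x + (- y + z)       ≈⟨ x+[y+z]≈[x+z]+y x (- y) z ⟩
      (x + z) - y         ∎

  divide-by-unit : ∀ {m u w v} → m * u ≈ w → u * v ≈ 1# → m ≈ w * v
  divide-by-unit {m} {u} {w} {v} mu≈w uv≈1 = begin
    m            ≈⟨ *-identityʳ m ⟨
    m * 1#       ≈⟨ *-congˡ uv≈1 ⟨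
    m * (u * v)  ≈⟨ *-assoc m u v ⟨
    (m * u) * v  ≈⟨ *-congʳ mu≈w ⟩
    w * v        ∎

module ValuationRingGeometry (R : FiniteValuationRing) where
  open FiniteValuationRing R
  open CommutativeRingLemmas cring
  open import Algebra.Properties.Ring ring
    using (-1*x≈-x; x[y-z]≈xy-xz; -‿distribˡ-*; -‿distribʳ-*)
  open import Algebra.Properties.Group +-group
    using (∙-cancelʳ; \\-leftDividesˡ; y≈x\\z; ⁻¹-involutive)
  open import Relation.Binary.Reasoning.Setoid setoid

  unit? : ∀ x → Dec (IsUnit x)
  unit? x with Any.any? (λ y → (x * y) ≟ 1#) elems
  ... | yes found = yes (Any.satisfied found)
  ... | no none   = no λ (v , xv≈1) →
    none (Any.map (λ v≈e → trans (*-congˡ (sym v≈e)) xv≈1) (complete v))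

  nonunit? : ∀ x → Dec (NonUnit x)
  nonunit? x = ¬? (unit? x)

  NonUnit-resp-≈ : ∀ {x y} → x ≈ y → NonUnit x → NonUnit y
  NonUnit-resp-≈ x≈y ¬ux (v , yv≈1) = ¬ux (v , trans (*-congʳ x≈y) yv≈1)

  NonUnit-neg : ∀ {x} → NonUnit x → NonUnit (- x)
  NonUnit-neg {x} ¬ux (v , -xv≈1) =
    ¬ux (- v , trans (sym (-‿distribʳ-* x v)) (trans (-‿distribˡ-* x v) -xv≈1))

  NonUnit-sub : ∀ {x y} → NonUnit x → NonUnit y → NonUnit (x - y)
  NonUnit-sub ¬ux ¬uy = local _ _ ¬ux (NonUnit-neg ¬uy)

  cosets-meet⇒NonUnit-diff : ∀ {s t z z'} → NonUnit z → NonUnit z' →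
                             s + z ≈ t + z' → NonUnit (s - t)
  cosets-meet⇒NonUnit-diff ¬uz ¬uz' eq =
    NonUnit-resp-≈ (sym (+≈+⇒-≈- (trans eq (+-comm _ _)))) (NonUnit-sub ¬uz' ¬uz)

  line : Carrier → Carrier → Coeffs
  line m c = m , - 1# , c

  line-isLine : ∀ m c → IsLineCoeffs (line m c)
  line-isLine m c (_ , ¬u-1 , _) =
    ¬u-1 (- 1# , trans (-1*x≈-x (- 1#)) (⁻¹-involutive 1#))

  onLine⇒ : ∀ {m c x y} → OnLine (line m c) (x , y) → m * x + c ≈ y
  onLine⇒ = proj₁ (x+[-1]y+z≈0⇔x+z≈y _ _ _)

  onLine⇐ : ∀ {m c x y} → m * x + c ≈ y → OnLine (line m c) (x , y)
  onLine⇐ = proj₂ (x+[-1]y+z≈0⇔x+z≈y _ _ _)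

  intercept : Carrier → Point → Carrier
  intercept m (x , y) = - (m * x) + y

  onLine⇒≈intercept : ∀ {m c} P → OnLine (line m c) P → c ≈ intercept m P
  onLine⇒≈intercept (x , y) on = y≈x\\z _ _ y (onLine⇒ on)

  ≈intercept⇒onLine : ∀ {m c} P → c ≈ intercept m P → OnLine (line m c) P
  ≈intercept⇒onLine {m} (x , y) c≈ = onLine⇐ (trans (+-congˡ c≈) (\\-leftDividesˡ (m * x) y))

  sameLine-setoid : Setoid _ _
  sameLine-setoid = record
    { Carrier       = Coeffs
    ; _≈_           = SameLine
    ; isEquivalence = record
      { refl  = λ _ → id , id
      ; sym   = λ ℓ≡m P → proj₂ (ℓ≡m P) , proj₁ (ℓ≡m P)
      ; trans = λ ℓ≡m m≡n P → proj₁ (m≡n P) ∘ proj₁ (ℓ≡m P) , proj₂ (ℓ≡m P) ∘ proj₂ (m≡n P)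
      }
    }

  -- Test the two lines at the points (0, c) and (1, m + c).
  line-injective : ∀ {m c m' c'} → SameLine (line m c) (line m' c') → m ≈ m' × c ≈ c'
  line-injective {m} {c} {m'} {c'} same = m≈m' , sym c'≈c
    where
    transfer : ∀ {x y} → m * x + c ≈ y → m' * x + c' ≈ y
    transfer on = onLine⇒ (proj₁ (same _) (onLine⇐ on))

    at0 : ∀ k d → k * 0# + d ≈ d
    at0 k d = trans (+-congʳ (zeroʳ k)) (+-identityˡ d)

    at1 : ∀ k d → k * 1# + d ≈ k + d
    at1 k d = +-congʳ (*-identityʳ k)

    c'≈c : c' ≈ c
    c'≈c = trans (sym (at0 m' c')) (transfer (at0 m c))

    m≈m' : m ≈ m'
    m≈m' = ∙-cancelʳ c m m' (sym (begin
      m' + c       ≈⟨ +-congˡ c'≈c ⟨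
      m' + c'      ≈⟨ at1 m' c' ⟨
      m' * 1# + c' ≈⟨ transfer (at1 m c) ⟩
      m + c        ∎))

  Δx Δy : Point → Point → Carrier
  Δx (x , _) (x' , _) = x' - x
  Δy (_ , y) (_ , y') = y' - y

  Aligned : Carrier → Point → Point → Set
  Aligned m P Q = m * Δx P Q ≈ Δy P Q

  aligned? : ∀ m P Q → Dec (Aligned m P Q)
  aligned? m P Q = (m * Δx P Q) ≟ Δy P Q

  onLine⇒aligned : ∀ {m c} P Q → OnLine (line m c) P → OnLine (line m c) Q → Aligned m P Q
  onLine⇒aligned {m} {c} (x , y) (x' , y') onP onQ = begin
    m * (x' - x)               ≈⟨ x[y-z]≈xy-xz m x' x ⟩
    m * x' - m * x             ≈⟨ [x+z]-[y+z]≈x-y (m * x') (m * x) c ⟨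
    (m * x' + c) - (m * x + c) ≈⟨ +-cong (onLine⇒ onQ) (-‿cong (onLine⇒ onP)) ⟩
    y' - y                     ∎

  along : Point → Carrier → Carrier → Point
  along (x , y) m u = x + u , y + m * u

  along-cong : ∀ P m {u v} → u ≈ v → along P m u ≈ₚ along P m v
  along-cong P m u≈v = +-congˡ u≈v , +-congˡ (*-congˡ u≈v)

  aligned⇒≈along : ∀ {m} P Q → Aligned m P Q → Q ≈ₚ along P m (Δx P Q)
  aligned⇒≈along (x , y) (x' , y') al =
    x≈y+[x-y] x' x , trans (x≈y+[x-y] y' y) (+-congˡ (sym al))

  point-setoid : Setoid _ _
  point-setoid = ×-setoid setoid setoid

-- Opened only from here on: the modules above use the ring's _+_, _*_, sym and trans.
open import Data.Nat.Base
open import Data.Nat.Properties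
open import Data.Nat.Primality using (prime⇒nonZero)
open import Data.Nat.Tactic.RingSolver using (solve-∀)
open import Algebra.Properties.CommutativeSemigroup +-commutativeSemigroup using (interchange)
open import Relation.Binary.PropositionalEquality using (_≡_; refl; sym; trans; cong; cong₂)

private variable
  a p : Level
  A B : Set a

All-cartesianProductWith⁺ : ∀ {C : Set a} {P : Pred A p} {Q : Pred B p} {S : Pred C p}
  (f : A → B → C) → (∀ {x y} → P x → Q y → S (f x y)) →
  ∀ {xs ys} → All P xs → All Q ys → All S (cartesianProductWith f xs ys)
All-cartesianProductWith⁺ f pres []         Qys = []
All-cartesianProductWith⁺ f pres (Px ∷ Pxs) Qys =
  All.++⁺ (All.map⁺ (All.map (pres Px) Qys)) (All-cartesianProductWith⁺ f pres Pxs Qys)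

∑ : List A → (A → ℕ) → ℕ
∑ []       f = 0
∑ (x ∷ xs) f = f x + ∑ xs f

syntax ∑ xs (λ x → e) = ∑[ x ∈ xs ] e

∑-cong : ∀ (xs : List A) {f g} → (∀ x → f x ≡ g x) → ∑ xs f ≡ ∑ xs g
∑-cong []       f≗g = refl
∑-cong (x ∷ xs) f≗g = cong₂ _+_ (f≗g x) (∑-cong xs f≗g)

∑-mono-≤ : ∀ (xs : List A) {f g} → (∀ x → f x ≤ g x) → ∑ xs f ≤ ∑ xs g
∑-mono-≤ []       f≤g = z≤n
∑-mono-≤ (x ∷ xs) f≤g = +-mono-≤ (f≤g x) (∑-mono-≤ xs f≤g)

∑-distrib-+ : ∀ (xs : List A) f g → ∑[ x ∈ xs ] (f x + g x) ≡ ∑ xs f + ∑ xs g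
∑-distrib-+ []       f g = refl
∑-distrib-+ (x ∷ xs) f g =
  trans (cong (f x + g x +_) (∑-distrib-+ xs f g)) (interchange (f x) (g x) _ _)

∑-distribˡ-* : ∀ (xs : List A) k f → ∑[ x ∈ xs ] (k * f x) ≡ k * ∑ xs f
∑-distribˡ-* []       k f = sym (*-zeroʳ k)
∑-distribˡ-* (x ∷ xs) k f =
  trans (cong (k * f x +_) (∑-distribˡ-* xs k f)) (sym (*-distribˡ-+ k (f x) _))

∑-const : ∀ (xs : List A) k → ∑[ _ ∈ xs ] k ≡ length xs * k
∑-const []       k = refl
∑-const (x ∷ xs) k = cong (k +_) (∑-const xs k)

∑-length : ∀ (xs : List A) → ∑[ _ ∈ xs ] 1 ≡ length xs
∑-length xs = trans (∑-const xs 1) (*-identityʳ (length xs))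

∑-comm : ∀ (xs : List A) (ys : List B) (f : A → B → ℕ) →
         ∑[ x ∈ xs ] ∑[ y ∈ ys ] f x y ≡ ∑[ y ∈ ys ] ∑[ x ∈ xs ] f x y
∑-comm []       ys f = sym (trans (∑-const ys 0) (*-zeroʳ (length ys)))
∑-comm (x ∷ xs) ys f =
  trans (cong (∑ ys (f x) +_) (∑-comm xs ys f)) (sym (∑-distrib-+ ys (f x) _))

∑*∑ : ∀ (xs : List A) (ys : List B) (f : A → ℕ) (g : B → ℕ) →
      ∑ xs f * ∑ ys g ≡ ∑[ x ∈ xs ] ∑[ y ∈ ys ] (f x * g y)
∑*∑ []       ys f g = refl
∑*∑ (x ∷ xs) ys f g = trans (*-distribʳ-+ (∑ ys g) (f x) _)
  (cong₂ _+_ (sym (∑-distribˡ-* ys (f x) g)) (∑*∑ xs ys f g))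

∑-++ : ∀ (xs ys : List A) f → ∑ (xs ++ ys) f ≡ ∑ xs f + ∑ ys f
∑-++ []       ys f = refl
∑-++ (x ∷ xs) ys f = trans (cong (f x +_) (∑-++ xs ys f)) (sym (+-assoc (f x) _ _))

∑-map : ∀ {C : Set a} (h : B → C) (xs : List B) f → ∑ (map h xs) f ≡ ∑[ x ∈ xs ] f (h x)
∑-map h []       f = refl
∑-map h (x ∷ xs) f = cong (f (h x) +_) (∑-map h xs f)

∑-cartesianProductWith : ∀ {C : Set a} (h : A → B → C) xs ys f →
  ∑ (cartesianProductWith h xs ys) f ≡ ∑[ x ∈ xs ] ∑[ y ∈ ys ] f (h x y)
∑-cartesianProductWith h []       ys f = refl
∑-cartesianProductWith h (x ∷ xs) ys f =
  trans (∑-++ (map (h x) ys) _ f)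
        (cong₂ _+_ (∑-map (h x) ys f) (∑-cartesianProductWith h xs ys f))

length-cartesianProductWith : ∀ {C : Set a} (h : A → B → C) xs ys →
  length (cartesianProductWith h xs ys) ≡ length xs * length ys
length-cartesianProductWith h xs ys = begin-equality
  length (cartesianProductWith h xs ys)   ≡⟨ ∑-length (cartesianProductWith h xs ys) ⟨
  ∑ (cartesianProductWith h xs ys) (λ _ → 1) ≡⟨ ∑-cartesianProductWith h xs ys _ ⟩
  ∑[ x ∈ xs ] ∑[ y ∈ ys ] 1              ≡⟨ ∑-cong xs (λ _ → ∑-length ys) ⟩
  ∑[ x ∈ xs ] length ys                  ≡⟨ ∑-const xs (length ys) ⟩
  length xs * length ys                  ∎
  where open ≤-Reasoning

𝟙 : {P : Set p} → Dec P → ℕ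
𝟙 P? = if does P? then 1 else 0

𝟙+𝟙¬≡1 : {P : Set p} (P? : Dec P) → 𝟙 P? + 𝟙 (¬? P?) ≡ 1
𝟙+𝟙¬≡1 (yes _) = refl
𝟙+𝟙¬≡1 (no _)  = refl

𝟙*𝟙≤𝟙*𝟙 : ∀ {A B C : Set p} (A? : Dec A) (B? : Dec B) (C? : Dec C) → (A → B → C) →
          𝟙 A? * 𝟙 B? ≤ 𝟙 C? * 𝟙 A?
𝟙*𝟙≤𝟙*𝟙 (yes a) (yes b) (yes _) _   = s≤s z≤n
𝟙*𝟙≤𝟙*𝟙 (yes a) (yes b) (no ¬c) a→b→c = ⊥-elim (¬c (a→b→c a b))
𝟙*𝟙≤𝟙*𝟙 (yes _) (no _)  _       _   = z≤n
𝟙*𝟙≤𝟙*𝟙 (no _)  _       _       _   = z≤n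

length-filter≡∑𝟙 : {P : Pred A p} (P? : Decidable P) → ∀ xs →
                   length (filter P? xs) ≡ ∑[ x ∈ xs ] 𝟙 (P? x)
length-filter≡∑𝟙 P? []       = refl
length-filter≡∑𝟙 P? (x ∷ xs) with P? x
... | yes _ = cong suc (length-filter≡∑𝟙 P? xs)
... | no _  = length-filter≡∑𝟙 P? xs

∑𝟙+∑𝟙¬≡length : {P : Pred A p} (P? : Decidable P) → ∀ xs →
                ∑[ x ∈ xs ] 𝟙 (P? x) + ∑[ x ∈ xs ] 𝟙 (¬? (P? x)) ≡ length xs
∑𝟙+∑𝟙¬≡length P? xs = trans (sym (∑-distrib-+ xs _ _))
  (trans (∑-cong xs (λ x → 𝟙+𝟙¬≡1 (P? x))) (∑-length xs))

Any⇒1≤∑𝟙 : {P : Pred A p} (P? : Decidable P) → ∀ {xs} → Any P xs → 1 ≤ ∑[ x ∈ xs ] 𝟙 (P? x)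
Any⇒1≤∑𝟙 P? {x ∷ xs} (here px) with P? x
... | yes _  = s≤s z≤n
... | no ¬px = ⊥-elim (¬px px)
Any⇒1≤∑𝟙 P? {x ∷ xs} (there pxs) = ≤-trans (Any⇒1≤∑𝟙 P? pxs) (m≤n+m _ (𝟙 (P? x)))

module _ {c ℓ} (S : Setoid c ℓ) where
  open Setoid S using (_≈_; _≉_) renaming (Carrier to X; sym to ≈-sym; trans to ≈-trans)
  open import Data.List.Membership.Setoid S using (_∈_)
  open import Data.List.Relation.Unary.Unique.Setoid S using (Unique)

  private
    remove : ∀ {x} ys → x ∈ ys → List X
    remove (y ∷ ys) (here _)     = ys
    remove (y ∷ ys) (there x∈ys) = y ∷ remove ys x∈ys

    length-remove : ∀ {x} ys (x∈ys : x ∈ ys) → suc (length (remove ys x∈ys)) ≡ length ys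
    length-remove (y ∷ ys) (here _)     = refl
    length-remove (y ∷ ys) (there x∈ys) = cong suc (length-remove ys x∈ys)

    ∈-remove : ∀ {x x'} ys (x∈ys : x ∈ ys) → x' ∈ ys → x ≉ x' → x' ∈ remove ys x∈ys
    ∈-remove (y ∷ ys) (here x≈y)   (here x'≈y)   x≉x' = ⊥-elim (x≉x' (≈-trans x≈y (≈-sym x'≈y)))
    ∈-remove (y ∷ ys) (here _)     (there x'∈ys) _    = x'∈ys
    ∈-remove (y ∷ ys) (there _)    (here x'≈y)   _    = here x'≈y
    ∈-remove (y ∷ ys) (there x∈ys) (there x'∈ys) x≉x' = there (∈-remove ys x∈ys x'∈ys x≉x')

  Unique-⊆⇒length≤ : ∀ {xs ys} → Unique xs → All (_∈ ys) xs → length xs ≤ length ys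
  Unique-⊆⇒length≤ []               []                = z≤n
  Unique-⊆⇒length≤ {ys = ys} (x≉xs ∷ xs!) (x∈ys ∷ xs⊆ys) = ≤-trans
    (s≤s (Unique-⊆⇒length≤ xs! (All.zipWith (λ (x≉x' , x'∈ys) → ∈-remove ys x∈ys x'∈ys x≉x')
                                            (x≉xs , xs⊆ys))))
    (≤-reflexive (length-remove ys x∈ys))

  Unique⇒∑𝟙≤1 : {P : Pred X p} (P? : Decidable P) → ∀ {xs} → Unique xs →
                ∀ t → (∀ {x} → P x → x ≈ t) → ∑[ x ∈ xs ] 𝟙 (P? x) ≤ 1
  Unique⇒∑𝟙≤1 P? {xs} xs! t P⇒≈t = begin
    ∑[ x ∈ xs ] 𝟙 (P? x)   ≡⟨ length-filter≡∑𝟙 P? xs ⟨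
    length (filter P? xs)  ≤⟨ Unique-⊆⇒length≤ {ys = t ∷ []} (AllPairs.filter⁺ P? xs!)
                               (All.map (here ∘ P⇒≈t) (All.all-filter P? xs)) ⟩
    1                      ∎
    where open ≤-Reasoning

∣m-n∣²+2nm≡m²+n² : ∀ m n → ∣ m - n ∣ * ∣ m - n ∣ + 2 * n * m ≡ m * m + n * n
∣m-n∣²+2nm≡m²+n² zero    n       = trans (cong (n * n +_) (*-zeroʳ (2 * n))) (+-identityʳ (n * n))
∣m-n∣²+2nm≡m²+n² (suc m) zero    = refl
∣m-n∣²+2nm≡m²+n² (suc m) (suc n) = begin-equality
  ∣ m - n ∣ * ∣ m - n ∣ + 2 * suc n * suc m
    ≡⟨ shift ∣ m - n ∣ m n ⟩
  (∣ m - n ∣ * ∣ m - n ∣ + 2 * n * m) + 2 * (m + n + 1)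
    ≡⟨ cong (_+ 2 * (m + n + 1)) (∣m-n∣²+2nm≡m²+n² m n) ⟩
  (m * m + n * n) + 2 * (m + n + 1)
    ≡⟨ square-suc m n ⟩
  suc m * suc m + suc n * suc n ∎
  where
  open ≤-Reasoning
  shift : ∀ d m n → d * d + 2 * suc n * suc m ≡ (d * d + 2 * n * m) + 2 * (m + n + 1)
  shift = solve-∀
  square-suc : ∀ m n → (m * m + n * n) + 2 * (m + n + 1) ≡ suc m * suc m + suc n * suc n
  square-suc = solve-∀

module _ {a} {A : Set a} (xs : List A) (f : A → ℕ) where

  ∑-deviation² : ∀ μ → ∑[ x ∈ xs ] (∣ f x - μ ∣ * ∣ f x - μ ∣) + 2 * μ * ∑ xs f
                       ≡ ∑[ x ∈ xs ] (f x * f x) + length xs * (μ * μ)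
  ∑-deviation² μ = begin-equality
    ∑[ x ∈ xs ] (∣ f x - μ ∣ * ∣ f x - μ ∣) + 2 * μ * ∑ xs f
      ≡⟨ cong (∑[ x ∈ xs ] (∣ f x - μ ∣ * ∣ f x - μ ∣) +_) (∑-distribˡ-* xs (2 * μ) f) ⟨
    ∑[ x ∈ xs ] (∣ f x - μ ∣ * ∣ f x - μ ∣) + ∑[ x ∈ xs ] (2 * μ * f x)
      ≡⟨ ∑-distrib-+ xs _ _ ⟨
    ∑[ x ∈ xs ] (∣ f x - μ ∣ * ∣ f x - μ ∣ + 2 * μ * f x)
      ≡⟨ ∑-cong xs (λ x → ∣m-n∣²+2nm≡m²+n² (f x) μ) ⟩
    ∑[ x ∈ xs ] (f x * f x + μ * μ)
      ≡⟨ ∑-distrib-+ xs _ _ ⟩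
    ∑[ x ∈ xs ] (f x * f x) + ∑[ x ∈ xs ] (μ * μ)
      ≡⟨ cong (∑[ x ∈ xs ] (f x * f x) +_) (∑-const xs (μ * μ)) ⟩
    ∑[ x ∈ xs ] (f x * f x) + length xs * (μ * μ) ∎
    where open ≤-Reasoning

  ∑-deviation²-below : ∀ Q d μ → Q + d ≤ μ →
    d * d * ∑[ x ∈ xs ] 𝟙 (¬? (Q + 1 ≤? f x)) ≤ ∑[ x ∈ xs ] (∣ f x - μ ∣ * ∣ f x - μ ∣)
  ∑-deviation²-below Q d μ Q+d≤μ = begin
    d * d * ∑[ x ∈ xs ] 𝟙 (¬? (Q + 1 ≤? f x))  ≡⟨ ∑-distribˡ-* xs (d * d) _ ⟨
    ∑[ x ∈ xs ] (d * d * 𝟙 (¬? (Q + 1 ≤? f x))) ≤⟨ ∑-mono-≤ xs pointwise ⟩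
    ∑[ x ∈ xs ] (∣ f x - μ ∣ * ∣ f x - μ ∣)     ∎
    where
    open ≤-Reasoning
    pointwise : ∀ x → d * d * 𝟙 (¬? (Q + 1 ≤? f x)) ≤ ∣ f x - μ ∣ * ∣ f x - μ ∣
    pointwise x = bound (Q + 1 ≤? f x)
      where
      bound : (rich? : Dec (Q + 1 ≤ f x)) → d * d * 𝟙 (¬? rich?) ≤ ∣ f x - μ ∣ * ∣ f x - μ ∣
      bound (yes _)    = ≤-trans (≤-reflexive (*-zeroʳ (d * d))) z≤n
      bound (no  poor) = ≤-trans (≤-reflexive (*-identityʳ (d * d))) (*-mono-≤ d≤dev d≤dev)
        where
        d≤dev : d ≤ ∣ f x - μ ∣
        d≤dev = +-cancelʳ-≤ (f x) d ∣ f x - μ ∣ (begin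
          d + f x           ≤⟨ +-monoʳ-≤ d fx≤Q ⟩
          d + Q             ≡⟨ +-comm d Q ⟩
          Q + d             ≤⟨ Q+d≤μ ⟩
          μ                 ≤⟨ m≤∣m-n∣+n μ (f x) ⟩
          ∣ μ - f x ∣ + f x ≡⟨ cong (_+ f x) (∣-∣-comm μ (f x)) ⟩
          ∣ f x - μ ∣ + f x ∎)
          where
          fx≤Q : f x ≤ Q
          fx≤Q = ≤-pred (≤-trans (≰⇒> poor) (≤-reflexive (+-comm Q 1)))

deviation²-bound : ∀ {q Q n M N S₁ S₂ D} → M ≡ q * Q → N ≡ 3 * (q * (Q * Q)) → n ≤ Q →
  N * M ≤ S₁ → S₂ ≤ N * (N + M * n) → D + 2 * (3 * Q) * S₁ ≡ S₂ + M * M * (3 * Q * (3 * Q)) →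
  D ≤ 3 * (M * M) * (Q * Q)
deviation²-bound {q} {Q} {n} {M} {N} {S₁} {S₂} {D} refl refl n≤Q NM≤S₁ S₂≤ identity =
  +-cancelʳ-≤ (2 * μ * (N * M)) D _ (begin
    D + 2 * μ * (N * M)               ≤⟨ +-monoʳ-≤ D (*-monoʳ-≤ (2 * μ) NM≤S₁) ⟩
    D + 2 * μ * S₁                    ≡⟨ identity ⟩
    S₂ + M * M * (μ * μ)              ≤⟨ +-monoˡ-≤ _ S₂≤ ⟩
    N * (N + M * n) + M * M * (μ * μ) ≤⟨ +-monoˡ-≤ _ (*-monoʳ-≤ N (+-monoʳ-≤ N (*-monoʳ-≤ M n≤Q))) ⟩
    N * (N + M * Q) + M * M * (μ * μ) ≡⟨ expand q Q ⟩
    3 * (M * M) * (Q * Q) + 2 * μ * (N * M) ∎)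
  where
  open ≤-Reasoning
  μ = 3 * Q
  expand : ∀ q Q → let M = q * Q ; N = 3 * (q * (Q * Q)) ; μ = 3 * Q in
    N * (N + M * Q) + M * M * (μ * μ) ≡ 3 * (M * M) * (Q * Q) + 2 * μ * (N * M)
  expand = solve-∀

quarter-bound : ∀ {Q M D Kr Kp} → 1 ≤ Q →
  2 * Q * (2 * Q) * Kp ≤ D → D ≤ 3 * (M * M) * (Q * Q) → Kr + Kp ≡ M * M → M * M ≤ 4 * Kr
quarter-bound {Q} {M} {D} {Kr} {Kp} 1≤Q poor≤D D≤ Kr+Kp≡M² =
  +-cancelʳ-≤ (3 * (M * M)) (M * M) (4 * Kr) (begin
    M * M + 3 * (M * M) ≡⟨⟩
    4 * (M * M)         ≡⟨ cong (4 *_) Kr+Kp≡M² ⟨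
    4 * (Kr + Kp)       ≡⟨ *-distribˡ-+ 4 Kr Kp ⟩
    4 * Kr + 4 * Kp     ≤⟨ +-monoʳ-≤ (4 * Kr) 4Kp≤3M² ⟩
    4 * Kr + 3 * (M * M) ∎)
  where
  open ≤-Reasoning
  instance
    Q²≢0 : NonZero (Q * Q)
    Q²≢0 = >-nonZero (*-mono-≤ 1≤Q 1≤Q)
  4Kp≤3M² : 4 * Kp ≤ 3 * (M * M)
  4Kp≤3M² = *-cancelʳ-≤ (4 * Kp) (3 * (M * M)) (Q * Q) (begin
    4 * Kp * (Q * Q)       ≡⟨ regroup Q Kp ⟩
    2 * Q * (2 * Q) * Kp   ≤⟨ ≤-trans poor≤D D≤ ⟩
    3 * (M * M) * (Q * Q)  ∎)
    where
    regroup : ∀ Q Kp → 4 * Kp * (Q * Q) ≡ 2 * Q * (2 * Q) * Kp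
    regroup = solve-∀

q^[2r]≡q^r*q^r : ∀ q r → q ^ (2 * r) ≡ q ^ r * q ^ r
q^[2r]≡q^r*q^r q r = trans (cong (λ k → q ^ (r + k)) (+-identityʳ r)) (^-distribˡ-+-* q r r)

q^[2[1+r]∸1]≡q*q^[2r] : ∀ q r → q ^ (2 * suc r ∸ 1) ≡ q * q ^ (2 * r)
q^[2[1+r]∸1]≡q*q^[2r] q r = cong (q ^_) (+-suc r (r + 0))

OddPrimePower⇒NonZero : ∀ {q} → OddPrimePower q → NonZero q
OddPrimePower⇒NonZero (p , k , p-prime , _ , _ , refl) =
  >-nonZero (m^n>0 p {{prime⇒nonZero p-prime}} k)

module Incidences (R : FiniteValuationRing) where
  open FiniteValuationRing R
    using (Carrier; setoid; elems; complete; distinct; NonUnit; IsUnit; ResidueFieldSize;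
           Point; _≈ₚ_; Coeffs; IsLineCoeffs; OnLine; onLine?; SameLine; pointsOn; +-group)
    renaming (_+_ to _+ᴿ_; _-_ to _-ᴿ_; _*_ to _*ᴿ_; sym to ≈-sym)
  open ValuationRingGeometry R
  open CommutativeRingLemmas (FiniteValuationRing.cring R) using (divide-by-unit)
  open import Algebra.Properties.Group +-group using (∙-cancelˡ)
  open import Data.List.Membership.Setoid point-setoid using () renaming (_∈_ to _∈ₚ_)
  open import Data.List.Membership.Setoid.Properties using (∈-resp-≈; ∈-map⁺; ∈-filter⁺)
  open import Data.List.Relation.Unary.Unique.Setoid setoid using (Unique)
  import Data.List.Relation.Unary.Unique.Setoid.Properties as Unique
  open ≤-Reasoning

  nonunits : List Carrier
  nonunits = filter nonunit? elems

  cosets-unique : ∀ {ts} → AllPairs (λ s t → ¬ NonUnit (s -ᴿ t)) ts →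
                  Unique (cartesianProductWith _+ᴿ_ ts nonunits)
  cosets-unique []            = []
  cosets-unique (s≁ts ∷ ts!) = AllPairs.++⁺
    (Unique.map⁺ setoid setoid (∙-cancelˡ _ _ _) (AllPairs.filter⁺ nonunit? distinct))
    (cosets-unique ts!)
    (All.map⁺ (All.map (λ ¬uz → All-cartesianProductWith⁺ _+ᴿ_
                                  (λ s≁t ¬uz' eq → s≁t (cosets-meet⇒NonUnit-diff ¬uz ¬uz' eq))
                                  s≁ts nonunits-nonunit)
                       nonunits-nonunit))
    where
    nonunits-nonunit : All NonUnit nonunits
    nonunits-nonunit = All.all-filter nonunit? elems

  residueField-bound : ∀ {q} → ResidueFieldSize q → q * length nonunits ≤ length elems
  residueField-bound {q} (reps , |reps|≡q , _ , reps!) = begin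
    q * length nonunits
      ≡⟨ cong (_* length nonunits) |reps|≡q ⟨
    length reps * length nonunits
      ≡⟨ length-cartesianProductWith _+ᴿ_ reps nonunits ⟨
    length (cartesianProductWith _+ᴿ_ reps nonunits)
      ≤⟨ Unique-⊆⇒length≤ setoid (cosets-unique reps!) (All.universal complete _) ⟩
    length elems ∎

  lines : List Coeffs
  lines = cartesianProductWith line elems elems

  lines-areLines : All IsLineCoeffs lines
  lines-areLines =
    All.cartesianProductWith⁺ setoid setoid line elems elems (λ _ _ → line-isLine _ _)

  lines-distinct : AllPairs (λ ℓ ℓ' → ¬ SameLine ℓ ℓ') lines
  lines-distinct =
    Unique.cartesianProductWith⁺ setoid setoid sameLine-setoid line line-injective distinct distinct

  length-lines : length lines ≡ length elems * length elems
  length-lines = length-cartesianProductWith line elems elems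

  ∑-lines : ∀ f → ∑ lines f ≡ ∑[ m ∈ elems ] ∑[ c ∈ elems ] f (line m c)
  ∑-lines = ∑-cartesianProductWith line elems elems

  lines-through-point : ∀ m P → ∑[ c ∈ elems ] 𝟙 (onLine? (line m c) P) ≡ 1
  lines-through-point m P = ≤-antisym
    (Unique⇒∑𝟙≤1 setoid (λ c → onLine? (line m c) P) distinct (intercept m P) (onLine⇒≈intercept P))
    (Any⇒1≤∑𝟙 (λ c → onLine? (line m c) P)
      (Any.map (≈intercept⇒onLine P ∘ ≈-sym) (complete (intercept m P))))

  common-lines≤aligned : ∀ m P Q →
    ∑[ c ∈ elems ] (𝟙 (onLine? (line m c) P) * 𝟙 (onLine? (line m c) Q)) ≤ 𝟙 (aligned? m P Q)
  common-lines≤aligned m P Q = begin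
    ∑[ c ∈ elems ] (𝟙 (onLine? (line m c) P) * 𝟙 (onLine? (line m c) Q))
      ≤⟨ ∑-mono-≤ elems (λ c → 𝟙*𝟙≤𝟙*𝟙 (onLine? (line m c) P) (onLine? (line m c) Q)
                                         (aligned? m P Q) (onLine⇒aligned P Q)) ⟩
    ∑[ c ∈ elems ] (𝟙 (aligned? m P Q) * 𝟙 (onLine? (line m c) P))
      ≡⟨ ∑-distribˡ-* elems (𝟙 (aligned? m P Q)) (λ c → 𝟙 (onLine? (line m c) P)) ⟩
    𝟙 (aligned? m P Q) * ∑[ c ∈ elems ] 𝟙 (onLine? (line m c) P)
      ≡⟨ cong (𝟙 (aligned? m P Q) *_) (lines-through-point m P) ⟩
    𝟙 (aligned? m P Q) * 1
      ≡⟨ *-identityʳ _ ⟩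
    𝟙 (aligned? m P Q) ∎

  unit-step⇒unique-slope : ∀ P Q → IsUnit (Δx P Q) → ∑[ m ∈ elems ] 𝟙 (aligned? m P Q) ≤ 1
  unit-step⇒unique-slope P Q (v , uv≈1) =
    Unique⇒∑𝟙≤1 setoid (λ m → aligned? m P Q) distinct (Δy P Q *ᴿ v) (λ al → divide-by-unit al uv≈1)

  -- A unit step Δx fixes the slope; a nonunit step is charged to the second summand.
  aligned-slopes≤ : ∀ P Q → ∑[ m ∈ elems ] 𝟙 (aligned? m P Q)
                            ≤ 1 + ∑[ m ∈ elems ] 𝟙 (nonunit? (Δx P Q) ×-dec aligned? m P Q)
  aligned-slopes≤ P Q = split (nonunit? (Δx P Q))
    where
    split : (nonunit?ᵤ : Dec (NonUnit (Δx P Q))) →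
            ∑[ m ∈ elems ] 𝟙 (aligned? m P Q) ≤ 1 + ∑[ m ∈ elems ] 𝟙 (nonunit?ᵤ ×-dec aligned? m P Q)
    split (yes _)   = m≤n+m _ 1
    split (no ¬¬u) =
      ≤-trans (unit-step⇒unique-slope P Q (decidable-stable (unit? (Δx P Q)) ¬¬u)) (m≤m+n 1 _)

  module WithPoints (E : List Point) (E! : AllPairs (λ P Q → ¬ P ≈ₚ Q) E) where

    pointsOn≡∑𝟙 : ∀ ℓ → pointsOn ℓ E ≡ ∑[ P ∈ E ] 𝟙 (onLine? ℓ P)
    pointsOn≡∑𝟙 ℓ = length-filter≡∑𝟙 (onLine? ℓ) E

    ∑-pointsOn : ∑[ ℓ ∈ lines ] pointsOn ℓ E ≡ length E * length elems
    ∑-pointsOn = begin-equality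
      ∑[ ℓ ∈ lines ] pointsOn ℓ E
        ≡⟨ ∑-cong lines pointsOn≡∑𝟙 ⟩
      ∑[ ℓ ∈ lines ] ∑[ P ∈ E ] 𝟙 (onLine? ℓ P)
        ≡⟨ ∑-comm lines E _ ⟩
      ∑[ P ∈ E ] ∑[ ℓ ∈ lines ] 𝟙 (onLine? ℓ P)
        ≡⟨ ∑-cong E (λ P → ∑-lines _) ⟩
      ∑[ P ∈ E ] ∑[ m ∈ elems ] ∑[ c ∈ elems ] 𝟙 (onLine? (line m c) P)
        ≡⟨ ∑-cong E (λ P → ∑-cong elems (λ m → lines-through-point m P)) ⟩
      ∑[ P ∈ E ] ∑[ m ∈ elems ] 1
        ≡⟨ ∑-cong E (λ _ → ∑-length elems) ⟩
      ∑[ P ∈ E ] length elems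
        ≡⟨ ∑-const E (length elems) ⟩
      length E * length elems ∎

    -- The points counted are P + u(1, m) with u ∈ R⁰.
    aligned-nonunit-steps≤ : ∀ P m →
      ∑[ Q ∈ E ] 𝟙 (nonunit? (Δx P Q) ×-dec aligned? m P Q) ≤ length nonunits
    aligned-nonunit-steps≤ P m = begin
      ∑[ Q ∈ E ] 𝟙 (step? Q)            ≡⟨ length-filter≡∑𝟙 step? E ⟨
      length (filter step? E)           ≤⟨ Unique-⊆⇒length≤ point-setoid (AllPairs.filter⁺ step? E!)
                                             (All.map along-nonunit (All.all-filter step? E)) ⟩
      length (map (along P m) nonunits) ≡⟨ length-map (along P m) nonunits ⟩
      length nonunits                   ∎
      where
      step? : ∀ Q → Dec (NonUnit (Δx P Q) × Aligned m P Q)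
      step? Q = nonunit? (Δx P Q) ×-dec aligned? m P Q

      along-nonunit : ∀ {Q} → NonUnit (Δx P Q) × Aligned m P Q → Q ∈ₚ map (along P m) nonunits
      along-nonunit {Q} (¬u , al) =
        ∈-resp-≈ point-setoid (Setoid.sym point-setoid (aligned⇒≈along P Q al))
          (∈-map⁺ setoid point-setoid (along-cong P m)
            (∈-filter⁺ setoid nonunit? NonUnit-resp-≈ (complete (Δx P Q)) ¬u))

    aligned-pairs≤ : ∀ P → ∑[ Q ∈ E ] ∑[ m ∈ elems ] 𝟙 (aligned? m P Q)
                           ≤ length E + length elems * length nonunits
    aligned-pairs≤ P = begin
      ∑[ Q ∈ E ] ∑[ m ∈ elems ] 𝟙 (aligned? m P Q)
        ≤⟨ ∑-mono-≤ E (aligned-slopes≤ P) ⟩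
      ∑[ Q ∈ E ] (1 + ∑[ m ∈ elems ] 𝟙 (nonunit? (Δx P Q) ×-dec aligned? m P Q))
        ≡⟨ ∑-distrib-+ E _ _ ⟩
      ∑[ Q ∈ E ] 1 + ∑[ Q ∈ E ] ∑[ m ∈ elems ] 𝟙 (nonunit? (Δx P Q) ×-dec aligned? m P Q)
        ≡⟨ cong₂ _+_ (∑-length E) (∑-comm E elems _) ⟩
      length E + ∑[ m ∈ elems ] ∑[ Q ∈ E ] 𝟙 (nonunit? (Δx P Q) ×-dec aligned? m P Q)
        ≤⟨ +-monoʳ-≤ (length E) (∑-mono-≤ elems (aligned-nonunit-steps≤ P)) ⟩
      length E + ∑[ m ∈ elems ] length nonunits
        ≡⟨ cong (length E +_) (∑-const elems (length nonunits)) ⟩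
      length E + length elems * length nonunits ∎

    ∑-pointsOn²≤ : ∑[ ℓ ∈ lines ] (pointsOn ℓ E * pointsOn ℓ E)
                   ≤ length E * (length E + length elems * length nonunits)
    ∑-pointsOn²≤ = begin
      ∑[ ℓ ∈ lines ] (pointsOn ℓ E * pointsOn ℓ E)
        ≡⟨ ∑-cong lines (λ ℓ → trans (cong₂ _*_ (pointsOn≡∑𝟙 ℓ) (pointsOn≡∑𝟙 ℓ)) (∑*∑ E E _ _)) ⟩
      ∑[ ℓ ∈ lines ] ∑[ P ∈ E ] ∑[ Q ∈ E ] (𝟙 (onLine? ℓ P) * 𝟙 (onLine? ℓ Q))
        ≡⟨ trans (∑-comm lines E _) (∑-cong E (λ P → ∑-comm lines E _)) ⟩
      ∑[ P ∈ E ] ∑[ Q ∈ E ] ∑[ ℓ ∈ lines ] (𝟙 (onLine? ℓ P) * 𝟙 (onLine? ℓ Q))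
        ≡⟨ ∑-cong E (λ P → ∑-cong E (λ Q → ∑-lines _)) ⟩
      ∑[ P ∈ E ] ∑[ Q ∈ E ] ∑[ m ∈ elems ] ∑[ c ∈ elems ]
        (𝟙 (onLine? (line m c) P) * 𝟙 (onLine? (line m c) Q))
        ≤⟨ ∑-mono-≤ E (λ P → ∑-mono-≤ E (λ Q → ∑-mono-≤ elems (λ m → common-lines≤aligned m P Q))) ⟩
      ∑[ P ∈ E ] ∑[ Q ∈ E ] ∑[ m ∈ elems ] 𝟙 (aligned? m P Q)
        ≤⟨ ∑-mono-≤ E aligned-pairs≤ ⟩
      ∑[ P ∈ E ] (length E + length elems * length nonunits)
        ≡⟨ ∑-const E _ ⟩
      length E * (length E + length elems * length nonunits) ∎

    rich? : ∀ Q ℓ → Dec (Q + 1 ≤ pointsOn ℓ E)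
    rich? Q ℓ = Q + 1 ≤? pointsOn ℓ E

    rich-lines-quarter : ∀ {q Q} → 1 ≤ Q → length elems ≡ q * Q → length E ≡ 3 * (q * (Q * Q)) →
      length nonunits ≤ Q → length elems * length elems ≤ 4 * length (filter (rich? Q) lines)
    rich-lines-quarter {q} {Q} 1≤Q |R|≡ |E|≡ n≤Q = begin
      length elems * length elems
        ≤⟨ quarter-bound {M = length elems} 1≤Q
             (∑-deviation²-below lines (λ ℓ → pointsOn ℓ E) Q (2 * Q) (3 * Q) ≤-refl)
             deviation≤
             (trans (∑𝟙+∑𝟙¬≡length (rich? Q) lines) length-lines) ⟩
      4 * ∑[ ℓ ∈ lines ] 𝟙 (rich? Q ℓ)
        ≡⟨ cong (4 *_) (length-filter≡∑𝟙 (rich? Q) lines) ⟨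
      4 * length (filter (rich? Q) lines) ∎
      where
      deviation≤ : ∑[ ℓ ∈ lines ] (∣ pointsOn ℓ E - 3 * Q ∣ * ∣ pointsOn ℓ E - 3 * Q ∣)
                   ≤ 3 * (length elems * length elems) * (Q * Q)
      deviation≤ = deviation²-bound {q} |R|≡ |E|≡ n≤Q (≤-reflexive (sym ∑-pointsOn)) ∑-pointsOn²≤
        (trans (∑-deviation² lines (λ ℓ → pointsOn ℓ E) (3 * Q))
               (cong (λ L → ∑[ ℓ ∈ lines ] (pointsOn ℓ E * pointsOn ℓ E) + L * (3 * Q * (3 * Q)))
                     length-lines))

corollary4p3 : (R : FiniteValuationRing) (q r : ℕ) →
    OddPrimePower q → FiniteValuationRing.ResidueFieldSize R q →
    1 ≤ r → FiniteValuationRing.order R ≡ q ^ r →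
    (E : List (FiniteValuationRing.Point R)) →
    AllPairs (λ P Q → ¬ FiniteValuationRing._≈ₚ_ R P Q) E →
    length E ≡ 3 * q ^ (2 * r ∸ 1) →
    Σ (List (FiniteValuationRing.Coeffs R)) λ Ls →
        All (FiniteValuationRing.IsLineCoeffs R) Ls
      × All (λ ℓ → q ^ (r ∸ 1) + 1 ≤ FiniteValuationRing.pointsOn R ℓ E) Ls
      × AllPairs (λ ℓ m → ¬ FiniteValuationRing.SameLine R ℓ m) Ls
      × (q ^ (2 * r) ≤ 4 * length Ls)
corollary4p3 R q zero    _     _             ()  _   _ _  _
corollary4p3 R q (suc r) q-odd residue-field _ |R|≡ E E! |E|≡ =
  filter (rich? Q) lines ,
  All.filter⁺ (rich? Q) lines-areLines , All.all-filter (rich? Q) lines ,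
  AllPairs.filter⁺ (rich? Q) lines-distinct ,
  (begin
    q ^ (2 * suc r)                   ≡⟨ q^[2r]≡q^r*q^r q (suc r) ⟩
    q ^ suc r * q ^ suc r             ≡⟨ cong₂ _*_ |R|≡ |R|≡ ⟨
    length elems * length elems       ≤⟨ rich-lines-quarter {q} (m^n>0 q r) |R|≡ |E|≡3qQ² |R⁰|≤Q ⟩
    4 * length (filter (rich? Q) lines) ∎)
  where
  open Incidences R
  open WithPoints E E!
  open FiniteValuationRing R using (elems)
  open ≤-Reasoning
  instance
    q≢0 : NonZero q
    q≢0 = OddPrimePower⇒NonZero q-odd

  Q = q ^ r

  |E|≡3qQ² : length E ≡ 3 * (q * (Q * Q))
  |E|≡3qQ² = trans |E|≡ (cong (3 *_)
    (trans (q^[2[1+r]∸1]≡q*q^[2r] q r) (cong (q *_) (q^[2r]≡q^r*q^r q r))))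

  |R⁰|≤Q : length nonunits ≤ Q
  |R⁰|≤Q = *-cancelˡ-≤ q (≤-trans (residueField-bound residue-field) (≤-reflexive |R|≡))
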